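{- Let $\mathsf{CS}$ be an axiomatically appropriate constant specification. If $A_1,\dots,A_n\vdash_{\mathsf{CS}}F$, then there is a justification term $t(x_1,\dots,x_n)$, for justification variables $x_1,\dots,x_n$, such that $x_1\overset{1}{:}A_1,\dots,x_n\overset{1}{:}A_n\vdash_{\mathsf{CS}}t(x_1,\dots,x_n)\overset{1}{:}F$.
   Context: Justification terms are built from justification variables $x_1,x_2,\dots$ and justification constants $c,c_1,c_2,\dots$ by binary operations $\cdot$ and $+$. Formulas of $\mathsf{RPLJ}$: $A::=p\mid\bar r\mid A\&A\mid A\to A\mid t:A$ ($p$ a propositional variable, $r\in\mathbb Q\cap[0,1]$, $t$ a term). Abbreviations: $\neg A:=A\to\bar0$, $A\wedge B:=A\&(A\to B)$, $A\equiv B:=(A\to B)\&(B\to A)$, $t\overset{r}{:}A:=(\bar r\to t:A)\wedge(t:A\to\bar r)$. On $[0,1]$: $x*_Ly=\max(0,x+y-1)$, $x\Rightarrow_Ly=\min(1,1-x+y)$. Axiom schemes of $\mathsf{RPLJ}$: (BL1) $(A\to B)\to((B\to C)\to(A\to C))$; (BL2) $(A\&B)\to A$; (BL3) $(A\&B)\to(B\&A)$; (BL4) $(A\&(A\to B))\to(B\&(B\to A))$; (BL5a) $(A\to(B\to C))\to((A\&B)\to C)$; (BL5b) $((A\&B)\to C)\to(A\to(B\to C))$; (BL6) $((A\to B)\to C)\to(((B\to A)\to C)\to C)$; (BL7) $\bar0\to A$; (L) $\neg\neg A\to A$; (TC1) $(\bar r\to\bar{r'})\equiv\overline{r\Rightarrow_Lr'}$;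 (TC2) $(\bar r\&\bar{r'})\equiv\overline{r*_Lr'}$; (Appl) $s:(A\to B)\to(t:A\to(s\cdot t):B)$; (Sum) $s:A\to(s+t):A$, $s:A\to(t+s):A$. A constant specification $\mathsf{CS}$ is a downward closed set of formulas $c_{i_n}\overset{1}{:}\cdots\overset{1}{:}c_{i_1}\overset{1}{:}A$ ($n\ge1$, $c_{i_j}$ constants, $A$ an axiom instance) (with such a formula, $n\ge2$, it contains $c_{i_{n-1}}\overset1:\cdots\overset1:c_{i_1}\overset1:A$). $\mathsf{CS}$ is axiomatically appropriate if for each axiom instance $A$ there is a constant $c$ with $c\overset1:A\in\mathsf{CS}$, and for each $F\in\mathsf{CS}$ there is a constant $c$ with $c\overset1:F\in\mathsf{CS}$. $\mathsf{RPLJ}_{\mathsf{CS}}$ has the axioms above and the rules Modus Ponens and "derive any member of $\mathsf{CS}$". $T\vdash_{\mathsf{CS}}A$ means $A$ is derivable in $\mathsf{RPLJ}_{\mathsf{CS}}$ using members of $T$ as additional premises. -}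

module Defs where

open import Data.Nat as ℕ using (ℕ; suc)
open import Data.Rational as ℚ using (ℚ; 0ℚ; 1ℚ; _⊔_; _⊓_; _-_)
open import Data.Rational.Properties using (p≤p⊔q; p⊓q≤p; ⊔-lub; ≤-refl)
open import Data.Fin using (Fin; toℕ)
open import Data.Vec using (Vec; lookup)
open import Data.Product using (Σ; ∃; _×_; _,_)
open import Relation.Binary.PropositionalEquality using (_≡_)

record Q01 : Set where
  constructor q01
  field
    val : ℚ
    .lo : 0ℚ ℚ.≤ val
    .hi : val ℚ.≤ 1ℚ
open Q01 public

0≤1 : 0ℚ ℚ.≤ 1ℚ
0≤1 = ℚ.*≤* (Data.Integer.+≤+ ℕ.z≤n)
  where import Data.Integer

clamp : ℚ → Q01
clamp q = q01 (0ℚ ⊔ (1ℚ ⊓ q)) (p≤p⊔q 0ℚ (1ℚ ⊓ q)) (⊔-lub 0≤1 (p⊓q≤p 1ℚ q))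

-- Łukasiewicz t-norm  x *_L y = max(0, x + y - 1)
-- (the extra min(1,-) in clamp is vacuous for x,y ∈ [0,1])
_*L_ : Q01 → Q01 → Q01
x *L y = clamp ((val x ℚ.+ val y) - 1ℚ)

-- Łukasiewicz residuum  x ⇒_L y = min(1, 1 - x + y)
-- (the extra max(0,-) in clamp is vacuous for x,y ∈ [0,1])
_⇒L_ : Q01 → Q01 → Q01
x ⇒L y = clamp ((1ℚ - val x) ℚ.+ val y)

one : Q01
one = q01 1ℚ 0≤1 ≤-refl

data Term : Set where
  var   : ℕ → Term
  const : ℕ → Term
  _·_   : Term → Term → Term
  _⊕_   : Term → Term → Term

data _occursIn_ (k : ℕ) : Term → Set where
  here : k occursIn var k
  ·ˡ : ∀ {s t} → k occursIn s → k occursIn (s · t)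
  ·ʳ : ∀ {s t} → k occursIn t → k occursIn (s · t)
  ⊕ˡ : ∀ {s t} → k occursIn s → k occursIn (s ⊕ t)
  ⊕ʳ : ∀ {s t} → k occursIn t → k occursIn (s ⊕ t)

data Formula : Set where
  atom : ℕ → Formula
  tc   : Q01 → Formula
  _&_  : Formula → Formula → Formula
  _⇒_  : Formula → Formula → Formula
  _∶_  : Term → Formula → Formula

infixr 5 _⇒_
infixr 6 _&_ _∧_
infix 7 _∶_ _∶¹_

¬' : Formula → Formula
¬' A = A ⇒ tc (q01 0ℚ ≤-refl 0≤1)

_∧_ : Formula → Formula → Formula
A ∧ B = A & (A ⇒ B)

_≡'_ : Formula → Formula → Formula
A ≡' B = (A ⇒ B) & (B ⇒ A)

_∶[_]_ : Term → Q01 → Formula → Formula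
t ∶[ r ] A = (tc r ⇒ (t ∶ A)) ∧ ((t ∶ A) ⇒ tc r)

_∶¹_ : Term → Formula → Formula
t ∶¹ A = t ∶[ one ] A

data Axiom : Formula → Set where
  BL1  : ∀ A B C → Axiom ((A ⇒ B) ⇒ ((B ⇒ C) ⇒ (A ⇒ C)))
  BL2  : ∀ A B → Axiom ((A & B) ⇒ A)
  BL3  : ∀ A B → Axiom ((A & B) ⇒ (B & A))
  BL4  : ∀ A B → Axiom ((A & (A ⇒ B)) ⇒ (B & (B ⇒ A)))
  BL5a : ∀ A B C → Axiom ((A ⇒ (B ⇒ C)) ⇒ ((A & B) ⇒ C))
  BL5b : ∀ A B C → Axiom (((A & B) ⇒ C) ⇒ (A ⇒ (B ⇒ C)))
  BL6  : ∀ A B C → Axiom (((A ⇒ B) ⇒ C) ⇒ (((B ⇒ A) ⇒ C) ⇒ C))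
  BL7  : ∀ A → Axiom (tc (q01 0ℚ ≤-refl 0≤1) ⇒ A)
  L    : ∀ A → Axiom (¬' (¬' A) ⇒ A)
  TC1  : ∀ r r' → Axiom ((tc r ⇒ tc r') ≡' tc (r ⇒L r'))
  TC2  : ∀ r r' → Axiom ((tc r & tc r') ≡' tc (r *L r'))
  Appl : ∀ s t A B → Axiom ((s ∶ (A ⇒ B)) ⇒ ((t ∶ A) ⇒ ((s · t) ∶ B)))
  Sumˡ : ∀ s t A → Axiom ((s ∶ A) ⇒ ((s ⊕ t) ∶ A))
  Sumʳ : ∀ s t A → Axiom ((s ∶ A) ⇒ ((t ⊕ s) ∶ A))

data CSForm : Formula → Set where
  base : ∀ c A → Axiom A → CSForm (const c ∶¹ A)
  step : ∀ c F → CSForm F → CSForm (const c ∶¹ F)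

record ConstSpec : Set₁ where
  field
    mem       : Formula → Set
    shape     : ∀ F → mem F → CSForm F
    downward  : ∀ c F → mem (const c ∶¹ F) → CSForm F → mem F
open ConstSpec public

AxiomaticallyAppropriate : ConstSpec → Set
AxiomaticallyAppropriate CS =
  (∀ A → Axiom A → ∃ λ c → mem CS (const c ∶¹ A)) ×
  (∀ F → mem CS F → ∃ λ c → mem CS (const c ∶¹ F))

data _⊢[_]_ (T : Formula → Set) (CS : ConstSpec) : Formula → Set where
  hyp : ∀ {A} → T A → T ⊢[ CS ] A
  ax  : ∀ {A} → Axiom A → T ⊢[ CS ] A
  cs  : ∀ {A} → mem CS A → T ⊢[ CS ] A
  mp  : ∀ {A B} → T ⊢[ CS ] A → T ⊢[ CS ] (A ⇒ B) → T ⊢[ CS ] B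

setOf : ∀ {n} → Vec Formula n → Formula → Set
setOf {n} As F = Σ (Fin n) λ i → F ≡ lookup As i

-- the premise set {x_1 :¹ A_1, ..., x_n :¹ A_n}  (x_i = var i, i = 1..n)
justSetOf : ∀ {n} → Vec Formula n → Formula → Set
justSetOf {n} As F = Σ (Fin n) λ i → F ≡ (var (suc (toℕ i)) ∶¹ lookup As i)

module Submission where

-- The proof is by induction on the derivation of F from A_1,…,A_n and follows
-- the classical lifting argument of justification logic:
--   * a premise A_i is justified by the variable x_i, since x_i :¹ A_i is itself
--     a premise;
--   * an axiom instance or a member of CS is justified by a constant c, which
--     exists because CS is axiomatically appropriate, and c :¹ A is derivable
--     as a member of CS;
--   * modus ponens is mirrored by application: from s :¹ A and t :¹ (A → F)
--     we get (t · s) :¹ F by the axiom (Appl).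
-- Since the graded connective t :¹ A abbreviates (1̄ → t:A) ∧ (t:A → 1̄), the
-- last step needs t:A and t :¹ A to be interderivable; this rests on a few
-- derived rules of Hájek's basic logic (weakening, identity, &-introduction)
-- and on the derivability of the truth constant 1̄, proved first.

open import Defs
open import Data.Nat using (ℕ; suc; _≤_; s≤s; z≤n)
open import Data.Vec using (Vec)
open import Data.Fin using (Fin; toℕ)
open import Data.Fin.Properties using (toℕ<n)
open import Data.Product using (Σ; _×_; _,_)
open import Relation.Binary.PropositionalEquality using (refl)
open import Data.Rational using (0ℚ)
open import Data.Rational.Properties using (≤-refl)

module DerivedRules {T : Formula → Set} {CS : ConstSpec} where

  zero₀₁ : Q01
  zero₀₁ = q01 0ℚ ≤-refl 0≤1

  -- The truth constant 1̄ is a theorem: 0̄ → 0̄ holds by (BL7), and it is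
  -- equivalent to the constant 0 ⇒_L 0 = 1 by (TC1).
  ⊢1̄ : T ⊢[ CS ] tc one
  ⊢1̄ = mp (ax (BL7 (tc zero₀₁))) (mp (ax (TC1 zero₀₁ zero₀₁)) (ax (BL2 _ _)))

  -- Weakening (the K scheme), from (BL2) by exportation (BL5b).
  ⊢K : ∀ A B → T ⊢[ CS ] (A ⇒ (B ⇒ A))
  ⊢K A B = mp (ax (BL2 A B)) (ax (BL5b A B A))

  -- Internal modus ponens A → ((A → B) → B): from A & (A → B) → B, which
  -- follows from (BL4) and (BL2) by transitivity (BL1), by exportation.
  ⊢mp-internal : ∀ A B → T ⊢[ CS ] (A ⇒ ((A ⇒ B) ⇒ B))
  ⊢mp-internal A B = mp detach (ax (BL5b A (A ⇒ B) B))
    where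
    detach : T ⊢[ CS ] ((A & (A ⇒ B)) ⇒ B)
    detach = mp (ax (BL2 B (B ⇒ A)))
                (mp (ax (BL4 A B)) (ax (BL1 (A & (A ⇒ B)) (B & (B ⇒ A)) B)))

  -- Identity A → A: chain A → (1̄ → A) (weakening) with (1̄ → A) → A
  -- (internal modus ponens applied to the theorem 1̄).
  ⊢id : ∀ A → T ⊢[ CS ] (A ⇒ A)
  ⊢id A = mp (mp ⊢1̄ (⊢mp-internal (tc one) A))
             (mp (⊢K A (tc one)) (ax (BL1 A (tc one ⇒ A) A)))

  -- &-introduction, by exporting the identity on X & Z.
  &-intro : ∀ {X Z} → T ⊢[ CS ] X → T ⊢[ CS ] Z → T ⊢[ CS ] (X & Z)
  &-intro {X} {Z} x z = mp z (mp x (mp (⊢id (X & Z)) (ax (BL5b X Z (X & Z)))))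

  &-elimˡ : ∀ {X Z} → T ⊢[ CS ] (X & Z) → T ⊢[ CS ] X
  &-elimˡ p = mp p (ax (BL2 _ _))

  -- t:A yields t :¹ A = (1̄ → t:A) & ((1̄ → t:A) → (t:A → 1̄)):
  -- both implications hold by weakening, since t:A and 1̄ are theorems.
  ∶¹-intro : ∀ {t A} → T ⊢[ CS ] (t ∶ A) → T ⊢[ CS ] (t ∶¹ A)
  ∶¹-intro {t} {A} ⊢tA = &-intro oneToJ (mp jToOne (⊢K (t ∶ A ⇒ tc one) (tc one ⇒ t ∶ A)))
    where
    oneToJ : T ⊢[ CS ] (tc one ⇒ t ∶ A)
    oneToJ = mp ⊢tA (⊢K (t ∶ A) (tc one))
    jToOne : T ⊢[ CS ] (t ∶ A ⇒ tc one)
    jToOne = mp ⊢1̄ (⊢K (tc one) (t ∶ A))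

  ∶¹-elim : ∀ {t A} → T ⊢[ CS ] (t ∶¹ A) → T ⊢[ CS ] (t ∶ A)
  ∶¹-elim p = mp ⊢1̄ (&-elimˡ p)

  ∶¹-app : ∀ {s t A B} → T ⊢[ CS ] (s ∶¹ (A ⇒ B)) → T ⊢[ CS ] (t ∶¹ A) →
           T ⊢[ CS ] ((s · t) ∶¹ B)
  ∶¹-app {s} {t} {A} {B} ⊢s ⊢t =
    ∶¹-intro (mp (∶¹-elim ⊢t) (mp (∶¹-elim ⊢s) (ax (Appl s t A B))))

open DerivedRules

axiom-justification : ∀ {T CS A} → AxiomaticallyAppropriate CS →
  Axiom A → Σ ℕ λ c → T ⊢[ CS ] (const c ∶¹ A)
axiom-justification {A = A} (forAxioms , _) a =
  let c , c∈CS = forAxioms A a in c , cs c∈CS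

member-justification : ∀ {T CS A} → AxiomaticallyAppropriate CS →
  mem CS A → Σ ℕ λ c → T ⊢[ CS ] (const c ∶¹ A)
member-justification {A = A} (_ , forMembers) m =
  let c , c∈CS = forMembers A m in c , cs c∈CS

VarsBelow : ℕ → Term → Set
VarsBelow n t = ∀ k → k occursIn t → 1 ≤ k × k ≤ n

const-varsBelow : ∀ {n} c → VarsBelow n (const c)
const-varsBelow c k ()

var-varsBelow : ∀ {n} (i : Fin n) → VarsBelow n (var (suc (toℕ i)))
var-varsBelow i k here = s≤s z≤n , toℕ<n i

·-varsBelow : ∀ {n s t} → VarsBelow n s → VarsBelow n t → VarsBelow n (s · t)
·-varsBelow vs vt k (·ˡ o) = vs k o
·-varsBelow vs vt k (·ʳ o) = vt k o

lemma6 : (CS : ConstSpec) → AxiomaticallyAppropriate CS →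
    (n : ℕ) (As : Vec Formula n) (F : Formula) →
    setOf As ⊢[ CS ] F →
    Σ Term λ t → (∀ k → k occursIn t → 1 ≤ k × k ≤ n) × (justSetOf As ⊢[ CS ] (t ∶¹ F))
lemma6 CS aa n As F (hyp (i , refl)) =
  var (suc (toℕ i)) , var-varsBelow i , hyp (i , refl)
lemma6 CS aa n As F (ax a) =
  let c , ⊢c = axiom-justification aa a in const c , const-varsBelow c , ⊢c
lemma6 CS aa n As F (cs m) =
  let c , ⊢c = member-justification aa m in const c , const-varsBelow c , ⊢c
lemma6 CS aa n As F (mp {A} ⊢A ⊢A⇒F) =
  let s , vs , ⊢s = lemma6 CS aa n As A ⊢A
      t , vt , ⊢t = lemma6 CS aa n As (A ⇒ F) ⊢A⇒F
  in t · s , ·-varsBelow vt vs , ∶¹-app ⊢t ⊢s
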